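{- Let $\Gamma$ be a finite, connected, simple $d$-valent graph and let $G\leq \mathrm{Aut}(\Gamma)$ act transitively on the vertex-set of $\Gamma$. Then there exists a subgroup $H\leq G$ such that $H$ can be generated by $d$ elements and $H$ acts transitively on the vertex-set of $\Gamma$. -}

module Defs where

open import Data.Nat using (ℕ)
open import Data.Fin using (Fin)
open import Data.Fin.Permutation using (Permutation′; _⟨$⟩ʳ_; id; flip; _∘ₚ_)
open import Data.List using (List; length; filter; allFin)
open import Data.Vec using (Vec; lookup)
open import Data.Product using (Σ; ∃; _×_; _,_)
open import Relation.Nullary using (¬_; Dec)
open import Relation.Binary.PropositionalEquality using (_≡_)
open import Relation.Binary.Construct.Closure.ReflexiveTransitive using (Star)
open import Function.Bundles using (_⇔_)

record SimpleGraph (n : ℕ) : Set₁ where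
  field
    _~_    : Fin n → Fin n → Set
    adj?   : ∀ u v → Dec (u ~ v)
    ~-sym  : ∀ {u v} → u ~ v → v ~ u
    ~-irr  : ∀ {u} → ¬ (u ~ u)

module _ {n : ℕ} (Γ : SimpleGraph n) where
  open SimpleGraph Γ

  neighbours : Fin n → List (Fin n)
  neighbours v = filter (adj? v) (allFin n)

  degree : Fin n → ℕ
  degree v = length (neighbours v)

  Regular : ℕ → Set
  Regular d = ∀ v → degree v ≡ d

  Connected : Set
  Connected = ∀ u v → Star _~_ u v

  IsAutomorphism : Permutation′ n → Set
  IsAutomorphism π = ∀ u v → (u ~ v) ⇔ ((π ⟨$⟩ʳ u) ~ (π ⟨$⟩ʳ v))

record IsSubgroup {n : ℕ} (G : Permutation′ n → Set) : Set where
  field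
    resp   : ∀ {π ρ} → (∀ x → π ⟨$⟩ʳ x ≡ ρ ⟨$⟩ʳ x) → G π → G ρ
    id∈    : G id
    ∘∈     : ∀ {π ρ} → G π → G ρ → G (π ∘ₚ ρ)
    inv∈   : ∀ {π} → G π → G (flip π)

record IsAutSubgroup {n : ℕ} (Γ : SimpleGraph n) (G : Permutation′ n → Set) : Set where
  field
    isSubgroup : IsSubgroup G
    ⊆Aut       : ∀ π → G π → IsAutomorphism Γ π

Transitive : {n : ℕ} → (Permutation′ n → Set) → Set
Transitive {n} G = ∀ (u v : Fin n) → Σ (Permutation′ n) λ π → G π × (π ⟨$⟩ʳ u ≡ v)

-- The subgroup ⟨gs⟩ generated by a family of d permutations:
-- all permutations (extensionally) equal to a word in the generators.
data Word (n d : ℕ) : Set where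
  gen  : Fin d → Word n d
  one  : Word n d
  _·_  : Word n d → Word n d → Word n d
  inv  : Word n d → Word n d

eval : ∀ {n d} → Vec (Permutation′ n) d → Word n d → Permutation′ n
eval gs (gen i) = lookup gs i
eval gs one     = id
eval gs (w · v) = eval gs w ∘ₚ eval gs v
eval gs (inv w) = flip (eval gs w)

Generated : ∀ {n d} → Vec (Permutation′ n) d → Permutation′ n → Set
Generated {n} {d} gs π = Σ (Word n d) λ w → ∀ x → eval gs w ⟨$⟩ʳ x ≡ π ⟨$⟩ʳ x

module Submission where

-- Fix a base vertex v₀ of the d-valent graph Γ and list its
-- neighbours w₀, …, w_{d-1}.  By transitivity of G pick gᵢ ∈ G with
-- gᵢ(v₀) = wᵢ, and let H = ⟨g₀, …, g_{d-1}⟩ ≤ G.  The H-orbit of v₀ is closed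
-- under adjacency: if h(v₀) = x ~ y with h ∈ H, then h⁻¹(y) ~ v₀ because h is
-- an automorphism, so h⁻¹(y) = gᵢ(v₀) for some i and y = (h gᵢ)(v₀).  As Γ is
-- connected the orbit is all of V(Γ), and a group with a full orbit is
-- transitive.

open import Defs
open import Data.Nat using (ℕ; zero; suc)
open import Data.Fin using (Fin; cast)
import Data.Fin as Fin
open import Data.Fin.Properties using (cast-involutive)
open import Data.Fin.Permutation
  using (Permutation′; _⟨$⟩ʳ_; _⟨$⟩ˡ_; id; inverseˡ; inverseʳ)
open import Data.Vec using (Vec; lookup; tabulate; replicate)
open import Data.Vec.Properties using (lookup∘tabulate; lookup-replicate)
import Data.List as List
open import Data.List.Membership.Propositional using (_∈_)
open import Data.List.Relation.Unary.Any using (index)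
open import Data.List.Relation.Unary.Any.Properties using (lookup-index)
open import Data.List.Membership.Propositional.Properties using (∈-filter⁺; ∈-allFin)
open import Data.Product using (Σ; _×_; _,_; proj₁; proj₂)
open import Relation.Binary.PropositionalEquality
open import Relation.Binary.Construct.Closure.ReflexiveTransitive using (Star; ε; _◅_)
open import Function.Bundles using (Equivalence)

module _ {n : ℕ} (Γ : SimpleGraph n) where
  open SimpleGraph Γ

  neighbourAt : ∀ {d} → Regular Γ d → Fin n → Fin d → Fin n
  neighbourAt reg v i = List.lookup (neighbours Γ v) (cast (sym (reg v)) i)

  neighbourAt-onto : ∀ {d} (reg : Regular Γ d) v u → v ~ u →
                     Σ (Fin d) λ i → neighbourAt reg v i ≡ u
  neighbourAt-onto reg v u v~u = cast (reg v) (index u∈) , (begin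
      List.lookup (neighbours Γ v) (cast (sym (reg v)) (cast (reg v) (index u∈)))
    ≡⟨ cong (List.lookup (neighbours Γ v)) (cast-involutive (sym (reg v)) (reg v) (index u∈)) ⟩
      List.lookup (neighbours Γ v) (index u∈)
    ≡⟨ lookup-index u∈ ⟨
      u ∎)
    where
    open ≡-Reasoning
    u∈ : u ∈ neighbours Γ v
    u∈ = ∈-filter⁺ (adj? v) (∈-allFin u) v~u

  automorphism-pullback : ∀ {π : Permutation′ n} {u y} → IsAutomorphism Γ π →
                          (π ⟨$⟩ʳ u) ~ y → u ~ (π ⟨$⟩ˡ y)
  automorphism-pullback {π} {u} {y} π-aut πu~y =
    Equivalence.from (π-aut u (π ⟨$⟩ˡ y)) (subst ((π ⟨$⟩ʳ u) ~_) (sym (inverseʳ π)) πu~y)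

eval-∈ : ∀ {n d} {G : Permutation′ n → Set} → IsSubgroup G →
         (gs : Vec (Permutation′ n) d) → (∀ i → G (lookup gs i)) →
         ∀ ω → G (eval gs ω)
eval-∈ G-sub gs gs∈G (gen i) = gs∈G i
eval-∈ G-sub gs gs∈G one     = IsSubgroup.id∈ G-sub
eval-∈ G-sub gs gs∈G (ω · ω′) = IsSubgroup.∘∈ G-sub (eval-∈ G-sub gs gs∈G ω) (eval-∈ G-sub gs gs∈G ω′)
eval-∈ G-sub gs gs∈G (inv ω) = IsSubgroup.inv∈ G-sub (eval-∈ G-sub gs gs∈G ω)

InOrbit : ∀ {n d} → Vec (Permutation′ n) d → Fin n → Fin n → Set
InOrbit {n} {d} gs v u = Σ (Word n d) λ ω → eval gs ω ⟨$⟩ʳ v ≡ u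

module OrbitClosure {n d} (Γ : SimpleGraph n) (gs : Vec (Permutation′ n) d)
  (words-aut : ∀ ω → IsAutomorphism Γ (eval gs ω)) (v : Fin n)
  (reaches-neighbours : ∀ u → SimpleGraph._~_ Γ v u →
                        Σ (Fin d) λ i → lookup gs i ⟨$⟩ʳ v ≡ u) where
  open SimpleGraph Γ

  -- If h(v) = x ~ y then v ~ h⁻¹(y) = gᵢ(v) for some i, so y = (h gᵢ)(v).
  orbit-step : ∀ {x y} → x ~ y → InOrbit gs v x → InOrbit gs v y
  orbit-step {x} {y} x~y (ω , hv≡x) = (gen i · ω) , (begin
      h ⟨$⟩ʳ (lookup gs i ⟨$⟩ʳ v) ≡⟨ cong (h ⟨$⟩ʳ_) giv≡h⁻¹y ⟩
      h ⟨$⟩ʳ (h ⟨$⟩ˡ y)           ≡⟨ inverseʳ h ⟩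
      y                          ∎)
    where
    open ≡-Reasoning
    h = eval gs ω
    v~h⁻¹y : v ~ (h ⟨$⟩ˡ y)
    v~h⁻¹y = automorphism-pullback Γ {h} (words-aut ω) (subst (_~ y) (sym hv≡x) x~y)
    i = proj₁ (reaches-neighbours _ v~h⁻¹y)
    giv≡h⁻¹y = proj₂ (reaches-neighbours _ v~h⁻¹y)

  orbit-walk : ∀ {x y} → Star _~_ x y → InOrbit gs v x → InOrbit gs v y
  orbit-walk ε             x∈ = x∈
  orbit-walk (x~z ◅ walk) x∈ = orbit-walk walk (orbit-step x~z x∈)

  orbit-full : Connected Γ → ∀ u → InOrbit gs v u
  orbit-full conn u = orbit-walk (conn v u) (one , refl)

-- A generated group with a full orbit acts transitively: u ↦ v ↦ u′.
full-orbit⇒transitive : ∀ {n d} (gs : Vec (Permutation′ n) d) (v : Fin n) →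
                        (∀ u → InOrbit gs v u) → Transitive (Generated gs)
full-orbit⇒transitive gs v orbit u u′ =
  eval gs (inv ω · ω′) , (inv ω · ω′ , λ _ → refl) , (begin
      eval gs ω′ ⟨$⟩ʳ (eval gs ω ⟨$⟩ˡ u)                    ≡⟨ cong (λ z → eval gs ω′ ⟨$⟩ʳ (eval gs ω ⟨$⟩ˡ z)) (sym ωv≡u) ⟩
      eval gs ω′ ⟨$⟩ʳ (eval gs ω ⟨$⟩ˡ (eval gs ω ⟨$⟩ʳ v))    ≡⟨ cong (eval gs ω′ ⟨$⟩ʳ_) (inverseˡ (eval gs ω)) ⟩
      eval gs ω′ ⟨$⟩ʳ v                                     ≡⟨ ω′v≡u′ ⟩
      u′                                                    ∎)
  where
  open ≡-Reasoning
  ω = proj₁ (orbit u)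
  ωv≡u = proj₂ (orbit u)
  ω′ = proj₁ (orbit u′)
  ω′v≡u′ = proj₂ (orbit u′)

module Transporters {n d} {G : Permutation′ n → Set} (T : Transitive G)
  (v : Fin n) (f : Fin d → Fin n) where

  transporters : Vec (Permutation′ n) d
  transporters = tabulate λ i → proj₁ (T v (f i))

  transporters-∈ : ∀ i → G (lookup transporters i)
  transporters-∈ i = subst G (sym (lookup∘tabulate _ i)) (proj₁ (proj₂ (T v (f i))))

  transporters-move : ∀ i → lookup transporters i ⟨$⟩ʳ v ≡ f i
  transporters-move i =
    trans (cong (_⟨$⟩ʳ v) (lookup∘tabulate _ i)) (proj₂ (proj₂ (T v (f i))))

lemma3p2 : (n d : ℕ) (Γ : SimpleGraph n) → Connected Γ → Regular Γ d →
    (G : Permutation′ n → Set) → IsAutSubgroup Γ G → Transitive G →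
    Σ (Vec (Permutation′ n) d) λ gs →
      (∀ i → G (lookup gs i)) × Transitive (Generated gs)
lemma3p2 zero d Γ conn reg G aut T =
  replicate d id , (λ i → subst G (sym (lookup-replicate i id)) id∈) , λ ()
  where open IsSubgroup (IsAutSubgroup.isSubgroup aut)
lemma3p2 (suc m) d Γ conn reg G aut T =
  transporters , transporters-∈ ,
  full-orbit⇒transitive transporters v₀ (OrbitClosure.orbit-full Γ transporters words-aut v₀ reaches conn)
  where
  open IsAutSubgroup aut
  v₀ = Fin.zero
  open Transporters T v₀ (neighbourAt Γ reg v₀)

  words-aut : ∀ ω → IsAutomorphism Γ (eval transporters ω)
  words-aut ω = ⊆Aut _ (eval-∈ isSubgroup transporters transporters-∈ ω)

  reaches : ∀ u → SimpleGraph._~_ Γ v₀ u → Σ (Fin d) λ i → lookup transporters i ⟨$⟩ʳ v₀ ≡ u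
  reaches u v₀~u = i , trans (transporters-move i) wᵢ≡u
    where
    i = proj₁ (neighbourAt-onto Γ reg v₀ u v₀~u)
    wᵢ≡u = proj₂ (neighbourAt-onto Γ reg v₀ u v₀~u)
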